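{- Let $\nu,\lambda$ be cardinals and $c:[\nu]^2\to\lambda$ a coloring. For $i\in\lambda$ define $\alpha\vartriangleleft_i\beta$ iff $\alpha<\beta$ and $\{\alpha,\beta\}$ is well-connected in the color $i$. Then $\vartriangleleft_i$ is a tree-ordering of $\nu$ (a strict partial order in which the set of predecessors of each element is well-ordered), and every branch of the resulting tree (a maximal $\vartriangleleft_i$-linearly ordered subset of $\nu$) is well-connected in the color $i$.
   Context: Given $c:[\nu]^2\to\lambda$, a set $X\subseteq\nu$ is well-connected in the color $i$ if for all $\alpha<\beta$ in $X$ there is a finite path from $\alpha$ to $\beta$ (in the complete graph on $\nu$) all of whose edges have color $i$ and all of whose vertices are $\geq\alpha$ (the vertices need not lie in $X$). -}

module Defs where

open import Level using (0ℓ)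
open import Data.Product using (Σ; _×_; proj₁)
open import Data.Sum using (_⊎_)
open import Relation.Nullary using (¬_)
open import Relation.Binary.PropositionalEquality using (_≡_)
open import Induction.WellFounded using (WellFounded)

-- The cardinal ν is modelled by its underlying set of ordinals: a type V with
-- a strict well-order _<_ (strict total order + well-founded).
-- A colouring c : [ν]^2 → λ is a function c : V → V → Λ of which only the
-- values c α β with α < β are used (the colour of the edge {α,β}).

module Coloring {V Λ : Set} (_<_ : V → V → Set) (c : V → V → Λ) where

  _≤_ : V → V → Set
  x ≤ y = x < y ⊎ x ≡ y

  EdgeCol : Λ → V → V → Set
  EdgeCol i x y = (x < y × c x y ≡ i) ⊎ (y < x × c y x ≡ i)

  data Walk (i : Λ) (lo : V) : V → V → Set where
    here : ∀ {x} → lo ≤ x → Walk i lo x x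
    step : ∀ {x y z} → lo ≤ x → EdgeCol i x y → Walk i lo y z → Walk i lo x z

  WellConnected : Λ → (V → Set) → Set
  WellConnected i X = ∀ α β → X α → X β → α < β → Walk i α α β

  Pair : V → V → V → Set
  Pair α β x = x ≡ α ⊎ x ≡ β

  Tri◁ : Λ → V → V → Set
  Tri◁ i α β = α < β × WellConnected i (Pair α β)

record IsTreeOrder {V : Set} (_◁_ : V → V → Set) : Set₁ where
  field
    irrefl    : ∀ x → ¬ (x ◁ x)
    trans     : ∀ {x y z} → x ◁ y → y ◁ z → x ◁ z
    predWF    : ∀ β → WellFounded (λ (a b : Σ V (λ α → α ◁ β)) → proj₁ a ◁ proj₁ b)
    predLinear : ∀ β α γ → α ◁ β → γ ◁ β → (α ◁ γ ⊎ α ≡ γ ⊎ γ ◁ α)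

IsChain : {V : Set} → (V → V → Set) → (V → Set) → Set
IsChain _◁_ B = ∀ x y → B x → B y → (x ◁ y ⊎ x ≡ y ⊎ y ◁ x)

IsBranch : {V : Set} → (V → V → Set) → (V → Set) → Set₁
IsBranch {V} _◁_ B = IsChain _◁_ B × (∀ (C : V → Set) → IsChain _◁_ C → (∀ x → B x → C x) → ∀ x → C x → B x)

module Submission where

open import Defs
open import Data.Product using (_×_)
open import Relation.Binary.PropositionalEquality using (_≡_)
open import Relation.Binary.Structures using (IsStrictTotalOrder)
open import Induction.WellFounded using (WellFounded)

open import Data.Product using (Σ; _,_; proj₁)
open import Data.Sum using (_⊎_; inj₁; inj₂)
open import Data.Empty using (⊥-elim)
open import Relation.Nullary using (¬_)
open import Relation.Binary.PropositionalEquality using (refl)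
open import Relation.Binary.Structures using (IsStrictPartialOrder)
open import Relation.Binary.Definitions using (Trichotomous; tri<; tri≈; tri>)
open import Induction.WellFounded using (module Subrelation)
import Relation.Binary.Construct.On as On

-- α ◁ β says that α and β are joined by an i-coloured walk staying ≥ α.
-- Concatenating such walks gives transitivity. For two predecessors α < γ
-- of β, the walk from α up to β followed by the reversed walk from γ to β
-- stays ≥ α, so α ◁ γ: the predecessors of β form a chain. Well-foundedness
-- is inherited from _<_, and a ◁-chain is well-connected pair by pair.

module WellConnectedness {V Λ : Set} (_<_ : V → V → Set)
  (spo : IsStrictPartialOrder _≡_ _<_) (c : V → V → Λ) (i : Λ) where

  open IsStrictPartialOrder spo using (irrefl; asym) renaming (trans to <-trans)
  open Coloring _<_ c

  _◁_ : V → V → Set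
  _◁_ = Tri◁ i

  ≤-trans : ∀ {x y z} → x ≤ y → y ≤ z → x ≤ z
  ≤-trans (inj₁ x<y) (inj₁ y<z) = inj₁ (<-trans x<y y<z)
  ≤-trans (inj₁ x<y) (inj₂ refl) = inj₁ x<y
  ≤-trans (inj₂ refl) y≤z = y≤z

  EdgeCol-sym : ∀ {x y} → EdgeCol i x y → EdgeCol i y x
  EdgeCol-sym (inj₁ e) = inj₂ e
  EdgeCol-sym (inj₂ e) = inj₁ e

  Walk-lowerBound : ∀ {lo x z} → Walk i lo x z → lo ≤ x
  Walk-lowerBound (here lo≤x) = lo≤x
  Walk-lowerBound (step lo≤x _ _) = lo≤x

  Walk-weaken : ∀ {lo lo′ x z} → lo ≤ lo′ → Walk i lo′ x z → Walk i lo x z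
  Walk-weaken lo≤lo′ (here p) = here (≤-trans lo≤lo′ p)
  Walk-weaken lo≤lo′ (step p e w) = step (≤-trans lo≤lo′ p) e (Walk-weaken lo≤lo′ w)

  _++ʷ_ : ∀ {lo x y z} → Walk i lo x y → Walk i lo y z → Walk i lo x z
  here _ ++ʷ w′ = w′
  step p e w ++ʷ w′ = step p e (w ++ʷ w′)

  Walk-reverse : ∀ {lo x z} → Walk i lo x z → Walk i lo z x
  Walk-reverse (here p) = here p
  Walk-reverse (step p e w) =
    Walk-reverse w ++ʷ step (Walk-lowerBound w) (EdgeCol-sym e) (here p)

  ◁⇒< : ∀ {α β} → α ◁ β → α < β
  ◁⇒< = proj₁

  ◁⇒Walk : ∀ {α β} → α ◁ β → Walk i α α β
  ◁⇒Walk (α<β , wc) = wc _ _ (inj₁ refl) (inj₂ refl) α<β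

  Walk⇒◁ : ∀ {α β} → α < β → Walk i α α β → α ◁ β
  Walk⇒◁ {α} {β} α<β w = α<β , pair-wellConnected
    where
    pair-wellConnected : WellConnected i (Pair α β)
    pair-wellConnected _ _ (inj₁ refl) (inj₁ refl) α<α = ⊥-elim (irrefl refl α<α)
    pair-wellConnected _ _ (inj₁ refl) (inj₂ refl) _   = w
    pair-wellConnected _ _ (inj₂ refl) (inj₁ refl) β<α = ⊥-elim (asym α<β β<α)
    pair-wellConnected _ _ (inj₂ refl) (inj₂ refl) β<β = ⊥-elim (irrefl refl β<β)

  ◁-irrefl : ∀ α → ¬ (α ◁ α)
  ◁-irrefl α α◁α = irrefl refl (◁⇒< α◁α)

  ◁-trans : ∀ {α β γ} → α ◁ β → β ◁ γ → α ◁ γ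
  ◁-trans α◁β β◁γ = Walk⇒◁ (<-trans (◁⇒< α◁β) (◁⇒< β◁γ))
    (◁⇒Walk α◁β ++ʷ Walk-weaken (inj₁ (◁⇒< α◁β)) (◁⇒Walk β◁γ))

  ◁-join : ∀ {α γ β} → α < γ → α ◁ β → γ ◁ β → α ◁ γ
  ◁-join α<γ α◁β γ◁β =
    Walk⇒◁ α<γ (◁⇒Walk α◁β ++ʷ Walk-reverse (Walk-weaken (inj₁ α<γ) (◁⇒Walk γ◁β)))

  ◁-predecessors-linear : Trichotomous _≡_ _<_ →
    ∀ β α γ → α ◁ β → γ ◁ β → α ◁ γ ⊎ α ≡ γ ⊎ γ ◁ α
  ◁-predecessors-linear compare β α γ α◁β γ◁β with compare α γ
  ... | tri< α<γ _ _ = inj₁ (◁-join α<γ α◁β γ◁β)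
  ... | tri≈ _ α≡γ _ = inj₂ (inj₁ α≡γ)
  ... | tri> _ _ γ<α = inj₂ (inj₂ (◁-join γ<α γ◁β α◁β))

  ◁-predecessors-wellFounded : WellFounded _<_ → ∀ β →
    WellFounded (λ (a b : Σ V (_◁ β)) → proj₁ a ◁ proj₁ b)
  ◁-predecessors-wellFounded wf β =
    Subrelation.wellFounded ◁⇒< (On.wellFounded proj₁ wf)

  ◁-isTreeOrder : Trichotomous _≡_ _<_ → WellFounded _<_ → IsTreeOrder _◁_
  ◁-isTreeOrder compare wf = record
    { irrefl     = ◁-irrefl
    ; trans      = ◁-trans
    ; predWF     = ◁-predecessors-wellFounded wf
    ; predLinear = ◁-predecessors-linear compare
    }

  chain⇒wellConnected : ∀ {B : V → Set} → IsChain _◁_ B → WellConnected i B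
  chain⇒wellConnected chain α β Bα Bβ α<β with chain α β Bα Bβ
  ... | inj₁ α◁β = ◁⇒Walk α◁β
  ... | inj₂ (inj₁ refl) = ⊥-elim (irrefl refl α<β)
  ... | inj₂ (inj₂ β◁α) = ⊥-elim (asym α<β (◁⇒< β◁α))

lemma0p11 : {V Λ : Set} (_<_ : V → V → Set) → IsStrictTotalOrder _≡_ _<_ → WellFounded _<_ →
    (c : V → V → Λ) → (i : Λ) →
    IsTreeOrder (Coloring.Tri◁ _<_ c i)
      × (∀ (B : V → Set) → IsBranch (Coloring.Tri◁ _<_ c i) B → Coloring.WellConnected _<_ c i B)
lemma0p11 _<_ sto wf c i =
    ◁-isTreeOrder (IsStrictTotalOrder.compare sto) wf
  , λ B (chain , _) → chain⇒wellConnected chain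
  where open WellConnectedness _<_ (IsStrictTotalOrder.isStrictPartialOrder sto) c i
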